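{- For the single-machine makespan problem with uniform linear deterioration, on instances with two distinct release times (every job has $r_i\in\{0,r\}$ for some $r>0$), the best-of-two algorithm, which returns the schedule of smaller makespan among the Non-Idling schedule and the Non-Interfering schedule, is $2$-approximate.
   Context: Problem: a single machine must process a set $\mathcal{J}=\{1,\ldots,n\}$ of jobs non-preemptively, at most one job at a time. Job $i$ has a release time $r_i\ge 0$ and a fixed processing time $\alpha_i\ge 0$, and there is a common deterioration rate $\beta>0$. If job $i$ starts at time $s_i\ge r_i$, its processing time is $p_i(s_i)=\alpha_i+\beta s_i$, so it completes at $C_i=(1+\beta)s_i+\alpha_i$. A schedule is feasible if jobs do not overlap and $s_i\ge r_i$. The makespan is $\max_i C_i$; $T^*$ is the optimal makespan. An algorithm is $\rho$-approximate if its makespan is always at most $\rho T^*$. A job is pending at time $t$ if it is released by $t$ and has not started before $t$. Non-Idling algorithm: at each time $t$ that the machine becomes available and some job is pending, start a pending job with minimum $\alpha_i$ at time $t$ (otherwise wait for the next release). Non-Interfering algorithm: each time $t$ the machine becomes available, let $i$ be a pending job with minimum $\alpha_i$. If there is a job $j$ with $\alpha_j<\alpha_i$ and $t<r_j<(1+\beta)t+\alpha_i$, the machine stays idle during $[t,r_j)$ and the rule is reapplied at time $r_j$; otherwise $i$ is started at time $t$.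
   Formalization: The processing times $\alpha_i$, the release times, the rate $\beta$ and the start times of all schedules are rational numbers. -}

module Defs where

open import Data.Nat using (ℕ; zero; suc)
open import Data.Fin using (Fin; _≟_)
import Data.Fin as Fin
open import Data.Rational using (ℚ; 0ℚ; 1ℚ; _+_; _*_; _≤_; _<_; _⊔_)
open import Data.Maybe using (Maybe; just; nothing)
open import Data.Product using (_×_; ∃)
open import Data.Sum using (_⊎_)
open import Data.Bool using (if_then_else_)
open import Relation.Binary.PropositionalEquality using (_≡_; _≢_)
open import Relation.Nullary using (¬_; does)

record Instance (n : ℕ) : Set where
  field
    α   : Fin n → ℚ
    rel : Fin n → ℚ
    β   : ℚ
open Instance public

record Valid {n : ℕ} (I : Instance n) : Set where
  field
    β-pos   : 0ℚ < β I
    α-nonneg : ∀ i → 0ℚ ≤ α I i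
    r-nonneg : ∀ i → 0ℚ ≤ rel I i

completionAt : ∀ {n} → Instance n → Fin n → ℚ → ℚ
completionAt I i t = (1ℚ + β I) * t + α I i

-- A schedule is a vector of start times.
Schedule : ℕ → Set
Schedule n = Fin n → ℚ

Feasible : ∀ {n} → Instance n → Schedule n → Set
Feasible I s =
  (∀ i → rel I i ≤ s i) ×
  (∀ i j → i ≢ j → completionAt I i (s i) ≤ s j ⊎ completionAt I j (s j) ≤ s i)

-- maximum of finitely many rationals (0 for the empty family; all
-- completion times are ≥ 0 anyway)
maxF : ∀ {n} → (Fin n → ℚ) → ℚ
maxF {zero}  f = 0ℚ
maxF {suc n} f = f Fin.zero ⊔ maxF (λ k → f (Fin.suc k))

makespan : ∀ {n} → Instance n → Schedule n → ℚ
makespan I s = maxF (λ i → completionAt I i (s i))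

-- A partial schedule records, for each job, its start time if already
-- started (nothing = not yet started). Ties are broken arbitrarily:
-- the run relations are nondeterministic, so every tie-breaking is covered.

Partial : ℕ → Set
Partial n = Fin n → Maybe ℚ

assign : ∀ {n} → Partial n → Fin n → ℚ → Partial n
assign σ i v k = if does (k ≟ i) then just v else σ k

Pending : ∀ {n} → Instance n → Partial n → ℚ → Fin n → Set
Pending I σ t i = (rel I i ≤ t) × (σ i ≡ nothing)

MinPending : ∀ {n} → Instance n → Partial n → ℚ → Fin n → Set
MinPending I σ t i = Pending I σ t i × (∀ k → Pending I σ t k → α I i ≤ α I k)

NoPending : ∀ {n} → Instance n → Partial n → ℚ → Set
NoPending I σ t = ∀ k → ¬ Pending I σ t k

NextRelease : ∀ {n} → Instance n → Partial n → Fin n → Set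
NextRelease I σ j = (σ j ≡ nothing) × (∀ k → σ k ≡ nothing → rel I j ≤ rel I k)

-- NonIdlingRun I t σ s : running Non-Idling from state (machine available
-- at time t, partial schedule σ) can end with the complete schedule s.
data NonIdlingRun {n : ℕ} (I : Instance n) : ℚ → Partial n → Schedule n → Set where
  finish : ∀ {t σ s} → (∀ k → σ k ≡ just (s k)) → NonIdlingRun I t σ s
  start  : ∀ {t σ s} i → MinPending I σ t i →
           NonIdlingRun I (completionAt I i t) (assign σ i t) s →
           NonIdlingRun I t σ s
  wait   : ∀ {t σ s} j → NoPending I σ t → NextRelease I σ j →
           NonIdlingRun I (rel I j) σ s →
           NonIdlingRun I t σ s

data NonInterferingRun {n : ℕ} (I : Instance n) : ℚ → Partial n → Schedule n → Set where
  finish : ∀ {t σ s} → (∀ k → σ k ≡ just (s k)) → NonInterferingRun I t σ s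
  start  : ∀ {t σ s} i → MinPending I σ t i →
           (∀ j → α I j < α I i → t < rel I j → ¬ (rel I j < completionAt I i t)) →
           NonInterferingRun I (completionAt I i t) (assign σ i t) s →
           NonInterferingRun I t σ s
  idle   : ∀ {t σ s} i j → MinPending I σ t i →
           α I j < α I i → t < rel I j → rel I j < completionAt I i t →
           NonInterferingRun I (rel I j) σ s →
           NonInterferingRun I t σ s
  wait   : ∀ {t σ s} j → NoPending I σ t → NextRelease I σ j →
           NonInterferingRun I (rel I j) σ s →
           NonInterferingRun I t σ s

NonIdlingSchedule : ∀ {n} → Instance n → Schedule n → Set
NonIdlingSchedule I s = NonIdlingRun I 0ℚ (λ _ → nothing) s

NonInterferingSchedule : ∀ {n} → Instance n → Schedule n → Set
NonInterferingSchedule I s = NonInterferingRun I 0ℚ (λ _ → nothing) s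

TwoReleaseTimes : ∀ {n} → Instance n → ℚ → Set
TwoReleaseTimes I r = ∀ i → rel I i ≡ 0ℚ ⊎ rel I i ≡ r

{-# OPTIONS --safe #-}
-- Let q = 1 + β and let T be the makespan of a feasible schedule s. Run back to
-- back from time t, a sequence of m jobs ends at q^m·t plus a constant; exchanging
-- adjacent jobs shows that SPT order (smallest α first) ends earliest among sequences
-- of as many jobs, and s itself can be compressed into such a sequence, so every SPT
-- block ends by T. Both algorithms run the jobs released at 0 in SPT order until some
-- job straddles r, and afterwards the remaining m jobs in SPT order, which gives a
-- makespan of at most q^m·θ + T, with θ the end of the straddling job for Non-Idling
-- and θ = qr for Non-Interfering. If an SPT prefix of jobs released at 0 ends at or
-- after θ ≤ qr, fewer jobs than it contains complete before θ in s, so m + 1 jobs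
-- complete after θ and q^m·θ ≤ T. This bounds Non-Idling when its straddling job ends
-- by qr, and Non-Interfering otherwise, since its prefix before r is then at least as
-- long.
module Submission where

open import Defs
open import Data.Nat as ℕ using (ℕ; zero; suc)
import Data.Nat.Properties as ℕ
open import Data.Rational using (ℚ; 0ℚ; 1ℚ; _+_; _*_; _≤_; _<_; _⊓_; nonNegative; positive)
open import Data.Rational.Properties hiding (_≟_)
open import Data.Rational.Solver using (module +-*-Solver)
open import Data.Maybe using (Maybe; just; nothing; fromMaybe; maybe′)
open import Data.Maybe.Properties using (just-injective)
open import Data.Product using (_×_; ∃; ∃₂; _,_; proj₁; proj₂)
open import Data.Sum using (_⊎_; inj₁; inj₂; [_,_]′)
open import Data.Fin using (Fin; _≟_)
open import Data.Fin.Properties using (any?)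
import Data.Fin as Fin
open import Data.List using (List; []; _∷_; _++_; _∷ʳ_; [_]; length; foldl; filter)
open import Data.List.Properties using (length-++; length-++-sucʳ; ++-assoc; foldl-++; length-removeAt′)
open import Data.List.Membership.Propositional using (_∈_; _∉_; _─_)
open import Data.List.Membership.Propositional.Properties using (∈-++⁻; ∈-++⁺ˡ; ∈-++⁺ʳ; ∈-filter⁻)
import Data.List.Membership.DecPropositional as DecMembership
open import Data.List.Relation.Unary.Any using (here; there; index)
import Data.List.Relation.Unary.All as All
open All using (lookup)
open import Data.List.Relation.Unary.All.Properties using (¬Any⇒All¬)
import Data.List.Relation.Unary.AllPairs as AllPairs
open AllPairs using ([]; _∷_)
open import Data.List.Relation.Unary.Unique.Propositional using (Unique)
open import Data.List.Relation.Unary.Unique.Propositional.Properties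
  using (Unique[x∷xs]⇒x∉xs; ++⁺; filter⁺)
open import Data.List.Relation.Binary.Subset.Propositional using (_⊆_)
import Data.List.Extrema as Extrema
open import Data.Empty using (⊥; ⊥-elim)
open import Relation.Nullary using (¬_; yes; no; does)
open import Relation.Nullary.Decidable using (_×-dec_)
open import Function using (_∘_)
open import Relation.Unary using (Decidable)
open import Relation.Unary.Properties using (∁?)
open import Relation.Binary.Bundles using (DecTotalOrder)
open import Data.Bool using (true; false)
open import Relation.Binary.PropositionalEquality hiding ([_])

open Extrema (DecTotalOrder.totalOrder ≤-decTotalOrder)
  using (argmin; argmax; argmin-all; argmax-all; f[argmin]≤f[⊤]; f[argmin]≤f[xs]; f[⊥]≤f[argmax]; f[xs]≤f[argmax])

0≤1 : 0ℚ ≤ 1ℚ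
0≤1 = <⇒≤ (positive⁻¹ 1ℚ)

*-monoˡ-≤-≥0 : ∀ {a b} c → 0ℚ ≤ c → a ≤ b → c * a ≤ c * b
*-monoˡ-≤-≥0 c c≥0 = *-monoˡ-≤-nonNeg c {{nonNegative c≥0}}

*-monoʳ-≤-≥0 : ∀ {a b} c → 0ℚ ≤ c → a ≤ b → a * c ≤ b * c
*-monoʳ-≤-≥0 c c≥0 = *-monoʳ-≤-nonNeg c {{nonNegative c≥0}}

*-nonneg : ∀ {a b} → 0ℚ ≤ a → 0ℚ ≤ b → 0ℚ ≤ a * b
*-nonneg {a} {b} a≥0 b≥0 =
  nonNegative⁻¹ (a * b) {{nonNeg*nonNeg⇒nonNeg a {{nonNegative a≥0}} b {{nonNegative b≥0}}}}

≤-+-≥0 : ∀ a {b} → 0ℚ ≤ b → a ≤ a + b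
≤-+-≥0 a {b} b≥0 = ≤-trans (≤-reflexive (sym (+-identityʳ a))) (+-monoʳ-≤ a b≥0)

maxF-upper : ∀ {m} (g : Fin m → ℚ) i → g i ≤ maxF g
maxF-upper g Fin.zero    = p≤p⊔q (g Fin.zero) _
maxF-upper g (Fin.suc i) = ≤-trans (maxF-upper (λ k → g (Fin.suc k)) i) (p≤q⊔p (g Fin.zero) _)

maxF-nonneg : ∀ {m} (g : Fin m → ℚ) → 0ℚ ≤ maxF g
maxF-nonneg {zero}  g = ≤-refl
maxF-nonneg {suc m} g = ≤-trans (maxF-nonneg (λ k → g (Fin.suc k))) (p≤q⊔p (g Fin.zero) _)

maxF-least : ∀ {m} (g : Fin m → ℚ) {M} → 0ℚ ≤ M → (∀ i → g i ≤ M) → maxF g ≤ M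
maxF-least {zero}  g M≥0 g≤M = M≥0
maxF-least {suc m} g M≥0 g≤M =
  ⊔-lub (g≤M Fin.zero) (maxF-least (λ k → g (Fin.suc k)) M≥0 (λ k → g≤M (Fin.suc k)))

argmin-Fin : ∀ {m} {P : Fin m → Set} → Decidable P → (g : Fin m → ℚ) →
             (∀ i → ¬ P i) ⊎ ∃ λ i → P i × (∀ k → P k → g i ≤ g k)
argmin-Fin {zero} P? g = inj₁ (λ ())
argmin-Fin {suc m} P? g with argmin-Fin (λ i → P? (Fin.suc i)) (λ i → g (Fin.suc i)) | P? Fin.zero
... | inj₁ none | no ¬p0 = inj₁ λ { Fin.zero → ¬p0 ; (Fin.suc k) → none k }
... | inj₁ none | yes p0 = inj₂ (Fin.zero , p0 , λ { Fin.zero _ → ≤-refl ; (Fin.suc k) pk → ⊥-elim (none k pk) })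
... | inj₂ (i , pi , min) | no ¬p0 = inj₂ (Fin.suc i , pi , λ { Fin.zero p0 → ⊥-elim (¬p0 p0) ; (Fin.suc k) pk → min k pk })
... | inj₂ (i , pi , min) | yes p0 with g Fin.zero ≤? g (Fin.suc i)
...   | yes le = inj₂ (Fin.zero , p0 , λ { Fin.zero _ → ≤-refl ; (Fin.suc k) pk → ≤-trans le (min k pk) })
...   | no nle = inj₂ (Fin.suc i , pi , λ { Fin.zero _ → <⇒≤ (≰⇒> nle) ; (Fin.suc k) pk → min k pk })

module _ {A : Set} where

  unique-∷ : ∀ {x : A} {xs} → x ∉ xs → Unique xs → Unique (x ∷ xs)
  unique-∷ {xs = xs} x∉xs u = ¬Any⇒All¬ xs x∉xs ∷ u

  ∈-─⁻ : ∀ {x y : A} {xs} (p : x ∈ xs) → y ∈ xs ─ p → y ∈ xs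
  ∈-─⁻ (here _)  y∈    = there y∈
  ∈-─⁻ (there p) (here e)  = here e
  ∈-─⁻ (there p) (there y∈) = there (∈-─⁻ p y∈)

  unique-─ : ∀ {x : A} {xs} → Unique xs → (p : x ∈ xs) → Unique (xs ─ p)
  unique-─ (_ ∷ u) (here _)  = u
  unique-─ u@(_ ∷ u′) (there p) =
    unique-∷ (λ z∈ → Unique[x∷xs]⇒x∉xs u (∈-─⁻ p z∈)) (unique-─ u′ p)

  ∉-─ : ∀ {x : A} {xs} → Unique xs → (p : x ∈ xs) → x ∉ xs ─ p
  ∉-─ u (here refl) = Unique[x∷xs]⇒x∉xs u
  ∉-─ u (there p) (here refl) = Unique[x∷xs]⇒x∉xs u p
  ∉-─ (_ ∷ u) (there p) (there x∈) = ∉-─ u p x∈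

  length-∷ʳ : ∀ (xs : List A) x → length (xs ∷ʳ x) ≡ suc (length xs)
  length-∷ʳ xs x = trans (length-++ xs) (ℕ.+-comm (length xs) 1)

  length-++-∷ : ∀ (xs : List A) y ys → length (xs ++ y ∷ ys) ≡ suc (length ys ℕ.+ length xs)
  length-++-∷ xs y ys = trans (length-++-sucʳ xs y ys) (cong suc (trans (length-++ xs) (ℕ.+-comm (length xs) (length ys))))

  length-filter-∁ : ∀ {P : A → Set} (P? : Decidable P) xs →
                    length (filter P? xs) ℕ.+ length (filter (∁? P?) xs) ≡ length xs
  length-filter-∁ P? [] = refl
  length-filter-∁ P? (x ∷ xs) with does (P? x)
  ... | true  = cong suc (length-filter-∁ P? xs)
  ... | false = trans (ℕ.+-suc _ _) (cong suc (length-filter-∁ P? xs))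

assign-self : ∀ {n} (σ : Partial n) i v → assign σ i v i ≡ just v
assign-self σ i v with i ≟ i
... | yes _   = refl
... | no i≢i = ⊥-elim (i≢i refl)

assign-other : ∀ {n} (σ : Partial n) i v {k} → k ≢ i → assign σ i v k ≡ σ k
assign-other σ i v {k} k≢i with k ≟ i
... | yes k≡i = ⊥-elim (k≢i k≡i)
... | no _    = refl

Unstarted : ∀ {n} → Partial n → Fin n → Set
Unstarted σ k = σ k ≡ nothing

unstarted? : ∀ {n} (σ : Partial n) → Decidable (Unstarted σ)
unstarted? σ k with σ k
... | nothing = yes refl
... | just _  = no λ ()

pending? : ∀ {n} (I : Instance n) σ t → Decidable (Pending I σ t)
pending? I σ t k = (rel I k ≤? t) ×-dec unstarted? σ k

unstartedCount : ∀ {n} → Partial n → ℕ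
unstartedCount {zero}  σ = 0
unstartedCount {suc n} σ = maybe′ (λ _ → 0) 1 (σ Fin.zero) ℕ.+ unstartedCount (σ ∘ Fin.suc)

unstartedCount-assign : ∀ {n} (σ : Partial n) i v → Unstarted σ i →
                        suc (unstartedCount (assign σ i v)) ≡ unstartedCount σ
unstartedCount-assign σ Fin.zero    v u rewrite u = refl
unstartedCount-assign σ (Fin.suc i) v u =
  trans (sym (ℕ.+-suc (maybe′ (λ _ → 0) 1 (σ Fin.zero)) _))
        (cong (maybe′ (λ _ → 0) 1 (σ Fin.zero) ℕ.+_) (unstartedCount-assign (σ ∘ Fin.suc) i v u))

unstartedCount-start : ∀ {n} (σ : Partial n) i v {k} → Unstarted σ i → unstartedCount σ ≡ suc k →
                       unstartedCount (assign σ i v) ≡ k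
unstartedCount-start σ i v ui count = ℕ.suc-injective (trans (unstartedCount-assign σ i v ui) count)

allStarted : ∀ {n} (σ : Partial n) → unstartedCount σ ≡ 0 → ∀ k → ¬ Unstarted σ k
allStarted σ none k u with () ← trans (unstartedCount-assign σ k 0ℚ u) none

completion : ∀ {n} (σ : Partial n) → (∀ k → ¬ Unstarted σ k) → ∃ λ s → ∀ k → σ k ≡ just (s k)
completion σ started = (λ k → fromMaybe 0ℚ (σ k)) , λ k → just-fromMaybe (σ k) (started k)
  where
    just-fromMaybe : ∀ (x : Maybe ℚ) → x ≢ nothing → x ≡ just (fromMaybe 0ℚ x)
    just-fromMaybe nothing  x≢nothing = ⊥-elim (x≢nothing refl)
    just-fromMaybe (just v) _         = refl

nonIdlingRun-exists : ∀ {n} (I : Instance n) k t σ → unstartedCount σ ≡ k → ∃ (NonIdlingRun I t σ)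
nonIdlingRun-exists I zero t σ none = proj₁ done , finish (proj₂ done)
  where done = completion σ (allStarted σ none)
nonIdlingRun-exists I (suc k) t σ count with argmin-Fin (pending? I σ t) (α I)
... | inj₂ (i , minPending) = proj₁ rest , start i minPending (proj₂ rest)
  where rest = nonIdlingRun-exists I k _ _ (unstartedCount-start σ i _ (proj₂ (proj₁ minPending)) count)
... | inj₁ noPending with argmin-Fin (unstarted? σ) (rel I)
...   | inj₁ started = proj₁ done , finish (proj₂ done)
  where done = completion σ started
...   | inj₂ (j , uj , next) with argmin-Fin (pending? I σ (rel I j)) (α I)
...     | inj₁ noPending′ = ⊥-elim (noPending′ j (≤-refl , uj))
...     | inj₂ (i , minPending) = proj₁ rest , wait j noPending (uj , next) (start i minPending (proj₂ rest))
  where rest = nonIdlingRun-exists I k _ _ (unstartedCount-start σ i _ (proj₂ (proj₁ minPending)) count)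

module Deteriorating {n : ℕ} (I : Instance n) (V : Valid I) where
  open Valid V
  open +-*-Solver
  open DecMembership (_≟_ {n}) using (_∈?_)

  q : ℚ
  q = 1ℚ + β I

  φ : Fin n → ℚ → ℚ
  φ = completionAt I

  β-nonneg : 0ℚ ≤ β I
  β-nonneg = <⇒≤ β-pos

  1≤q : 1ℚ ≤ q
  1≤q = ≤-+-≥0 1ℚ β-nonneg

  q-nonneg : 0ℚ ≤ q
  q-nonneg = ≤-trans 0≤1 1≤q

  φ-monoʳ : ∀ i {t t′} → t ≤ t′ → φ i t ≤ φ i t′
  φ-monoʳ i t≤t′ = +-monoˡ-≤ (α I i) (*-monoˡ-≤-≥0 q q-nonneg t≤t′)

  φ-mono-α : ∀ {i j} t → α I i ≤ α I j → φ i t ≤ φ j t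
  φ-mono-α t αi≤αj = +-monoʳ-≤ (q * t) αi≤αj

  φ-split : ∀ i t → φ i t ≡ t + (β I * t + α I i)
  φ-split i t = solve 3 (λ b t a → (con 1ℚ :+ b) :* t :+ a := t :+ (b :* t :+ a)) refl (β I) t (α I i)

  ≤φ : ∀ i {t} → 0ℚ ≤ t → t ≤ φ i t
  ≤φ i {t} t≥0 = ≤-trans (≤-+-≥0 t (+-mono-≤ (*-nonneg β-nonneg t≥0) (α-nonneg i))) (≤-reflexive (sym (φ-split i t)))

  φ-nonneg : ∀ i {t} → 0ℚ ≤ t → 0ℚ ≤ φ i t
  φ-nonneg i t≥0 = ≤-trans t≥0 (≤φ i t≥0)

  -- The two orders differ only in the term β·α of the job run first:
  -- (1+β)((1+β)t + a) + c = (1+β)²t + (a + c) + βa.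
  φ-exchange : ∀ i j t → α I i ≤ α I j → φ j (φ i t) ≤ φ i (φ j t)
  φ-exchange i j t αi≤αj = begin
    φ j (φ i t)                                 ≡⟨ twice t (α I i) (α I j) ⟩
    q * q * t + (α I i + α I j) + β I * α I i   ≤⟨ +-monoʳ-≤ (q * q * t + (α I i + α I j))
                                                             (*-monoˡ-≤-≥0 (β I) β-nonneg αi≤αj) ⟩
    q * q * t + (α I i + α I j) + β I * α I j   ≡⟨ cong (λ x → q * q * t + x + β I * α I j) (+-comm (α I i) (α I j)) ⟩
    q * q * t + (α I j + α I i) + β I * α I j   ≡⟨ sym (twice t (α I j) (α I i)) ⟩
    φ i (φ j t)                                 ∎
    where
      open ≤-Reasoning
      twice : ∀ t a c → q * (q * t + a) + c ≡ q * q * t + (a + c) + β I * a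
      twice t a c = solve 4 (λ b t a c → (con 1ℚ :+ b) :* ((con 1ℚ :+ b) :* t :+ a) :+ c
                                       := (con 1ℚ :+ b) :* (con 1ℚ :+ b) :* t :+ (a :+ c) :+ b :* a)
                            refl (β I) t a c

  blockEnd : ℚ → List (Fin n) → ℚ
  blockEnd = foldl (λ t i → φ i t)

  blockEnd-++ : ∀ t xs ys → blockEnd t (xs ++ ys) ≡ blockEnd (blockEnd t xs) ys
  blockEnd-++ = foldl-++ (λ t i → φ i t)

  blockEnd-monoʳ : ∀ l {t t′} → t ≤ t′ → blockEnd t l ≤ blockEnd t′ l
  blockEnd-monoʳ []      t≤t′ = t≤t′
  blockEnd-monoʳ (x ∷ l) t≤t′ = blockEnd-monoʳ l (φ-monoʳ x t≤t′)

  ≤blockEnd : ∀ l {t} → 0ℚ ≤ t → t ≤ blockEnd t l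
  ≤blockEnd []      t≥0 = ≤-refl
  ≤blockEnd (x ∷ l) t≥0 = ≤-trans (≤φ x t≥0) (≤blockEnd l (φ-nonneg x t≥0))

  blockEnd-nonneg : ∀ l {t} → 0ℚ ≤ t → 0ℚ ≤ blockEnd t l
  blockEnd-nonneg l t≥0 = ≤-trans t≥0 (≤blockEnd l t≥0)

  q^_ : ℕ → ℚ
  q^ zero  = 1ℚ
  q^ suc m = q^ m * q

  1≤q^ : ∀ m → 1ℚ ≤ q^ m
  1≤q^ zero    = ≤-refl
  1≤q^ (suc m) = begin
    1ℚ         ≤⟨ 1≤q^ m ⟩
    q^ m       ≡⟨ sym (*-identityʳ (q^ m)) ⟩
    q^ m * 1ℚ  ≤⟨ *-monoˡ-≤-≥0 (q^ m) (≤-trans 0≤1 (1≤q^ m)) 1≤q ⟩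
    q^ m * q   ∎
    where open ≤-Reasoning

  q^-nonneg : ∀ m → 0ℚ ≤ q^ m
  q^-nonneg m = ≤-trans 0≤1 (1≤q^ m)

  q^-mono : ∀ {m m′} → m ℕ.≤ m′ → q^ m ≤ q^ m′
  q^-mono {zero}  {m′}     _           = 1≤q^ m′
  q^-mono {suc m} {suc m′} (ℕ.s≤s m≤m′) = *-monoʳ-≤-≥0 q q-nonneg (q^-mono m≤m′)

  blockEnd-affine : ∀ l t → blockEnd t l ≡ q^ (length l) * t + blockEnd 0ℚ l
  blockEnd-affine []      t = sym (trans (cong (_+ 0ℚ) (*-identityˡ t)) (+-identityʳ t))
  blockEnd-affine (x ∷ l) t = begin
    blockEnd (φ x t) l                                ≡⟨ blockEnd-affine l (φ x t) ⟩
    Q * φ x t + blockEnd 0ℚ l                         ≡⟨ split Q t (α I x) (blockEnd 0ℚ l) ⟩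
    (Q * q) * t + (Q * φ x 0ℚ + blockEnd 0ℚ l)        ≡⟨ cong ((Q * q) * t +_) (sym (blockEnd-affine l (φ x 0ℚ))) ⟩
    (Q * q) * t + blockEnd (φ x 0ℚ) l                 ∎
    where
      open ≡-Reasoning
      Q = q^ (length l)
      split : ∀ Q t a R → Q * (q * t + a) + R ≡ (Q * q) * t + (Q * (q * 0ℚ + a) + R)
      split Q t a R = solve 5 (λ Q b t a R → Q :* ((con 1ℚ :+ b) :* t :+ a) :+ R
                                          := (Q :* (con 1ℚ :+ b)) :* t :+ (Q :* ((con 1ℚ :+ b) :* con 0ℚ :+ a) :+ R))
                              refl Q (β I) t a R

  q^*≤blockEnd : ∀ l {t} → 0ℚ ≤ t → q^ (length l) * t ≤ blockEnd t l
  q^*≤blockEnd l {t} t≥0 = begin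
    q^ (length l) * t                   ≤⟨ ≤-+-≥0 _ (blockEnd-nonneg l ≤-refl) ⟩
    q^ (length l) * t + blockEnd 0ℚ l   ≡⟨ sym (blockEnd-affine l t) ⟩
    blockEnd t l                        ∎
    where open ≤-Reasoning

  blockEnd-bubble : ∀ {m l} t (p : m ∈ l) → (∀ {y} → y ∈ l → α I m ≤ α I y) →
                    blockEnd t (m ∷ l ─ p) ≤ blockEnd t l
  blockEnd-bubble t (here refl) _ = ≤-refl
  blockEnd-bubble {m} {x ∷ l} t (there p) m-min =
    ≤-trans (blockEnd-monoʳ (l ─ p) (φ-exchange m x t (m-min (here refl))))
            (blockEnd-bubble (φ x t) p (m-min ∘ there))

  _∖_ : (Fin n → Set) → Fin n → Fin n → Set
  (S ∖ m) y = S y × y ≢ m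

  data SPTPrefix : (Fin n → Set) → List (Fin n) → Set₁ where
    []   : ∀ {S} → SPTPrefix S []
    pick : ∀ {S m g} → S m → (∀ {y} → S y → α I m ≤ α I y) → SPTPrefix (S ∖ m) g →
           SPTPrefix S (m ∷ g)

  sptPrefix-⊆ : ∀ {S g} → SPTPrefix S g → ∀ {y} → y ∈ g → S y
  sptPrefix-⊆ (pick Sm _ G) (here refl) = Sm
  sptPrefix-⊆ (pick Sm _ G) (there y∈)  = proj₁ (sptPrefix-⊆ G y∈)

  sptPrefix-unique : ∀ {S g} → SPTPrefix S g → Unique g
  sptPrefix-unique []            = []
  sptPrefix-unique (pick _ _ G) = unique-∷ (λ m∈ → proj₂ (sptPrefix-⊆ G m∈) refl) (sptPrefix-unique G)

  sptPrefix-resp : ∀ {S S′ g} → (∀ {y} → S y → S′ y) → (∀ {y} → S′ y → S y) → SPTPrefix S g → SPTPrefix S′ g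
  sptPrefix-resp to from []              = []
  sptPrefix-resp to from (pick Sm m-min G) =
    pick (to Sm) (m-min ∘ from) (sptPrefix-resp (λ (Sy , y≢) → to Sy , y≢) (λ (S′y , y≢) → from S′y , y≢) G)

  sptPrefix-∷ʳ : ∀ {S g m} → SPTPrefix S g → S m → m ∉ g → (∀ {y} → S y → y ∉ g → α I m ≤ α I y) →
                 SPTPrefix S (g ∷ʳ m)
  sptPrefix-∷ʳ []                Sm _   m-min = pick Sm (λ Sy → m-min Sy λ ()) []
  sptPrefix-∷ʳ (pick Sx x-min G) Sm m∉g m-min =
    pick Sx x-min (sptPrefix-∷ʳ G (Sm , m∉g ∘ here) (m∉g ∘ there)
                    (λ (Sy , y≢x) y∉g → m-min Sy λ { (here y≡x) → y≢x y≡x ; (there y∈g) → y∉g y∈g }))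

  -- Bring the first SPT job to the front of l by adjacent exchanges, or put it in
  -- place of the head of l if l does not contain it.
  sptPrefix-optimal : ∀ {S g l} → SPTPrefix S g → Unique l → (∀ {y} → y ∈ l → S y) →
                      length g ℕ.≤ length l → ∀ {t} → 0ℚ ≤ t → blockEnd t g ≤ blockEnd t l
  sptPrefix-optimal {l = l} [] _ _ _ t≥0 = ≤blockEnd l t≥0
  sptPrefix-optimal {l = []} (pick _ _ _) _ _ () _
  sptPrefix-optimal {g = m ∷ g} {x ∷ l} (pick Sm m-min G) u l⊆S len {t} t≥0 with m ∈? (x ∷ l)
  ... | yes p = ≤-trans
        (sptPrefix-optimal G (unique-─ u p) (λ y∈ → l⊆S (∈-─⁻ p y∈) , λ { refl → ∉-─ u p y∈ })
           (ℕ.≤-pred (ℕ.≤-trans len (ℕ.≤-reflexive (length-removeAt′ (x ∷ l) (index p))))) (φ-nonneg m t≥0))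
        (blockEnd-bubble t p (m-min ∘ l⊆S))
  ... | no m∉ = ≤-trans
        (sptPrefix-optimal G (AllPairs.tail u) (λ y∈ → l⊆S (there y∈) , λ { refl → m∉ (there y∈) })
           (ℕ.≤-pred len) (φ-nonneg m t≥0))
        (blockEnd-monoʳ l (φ-mono-α t (m-min (l⊆S (here refl)))))

  module LowerBounds (s : Schedule n) (F : Feasible I s) where

    C : Fin n → ℚ
    C i = φ i (s i)

    T : ℚ
    T = makespan I s

    C≤T : ∀ i → C i ≤ T
    C≤T = maxF-upper C

    T-nonneg : 0ℚ ≤ T
    T-nonneg = maxF-nonneg C

    T≤2T : T ≤ T + T
    T≤2T = ≤-+-≥0 T T-nonneg

    s-nonneg : ∀ i → 0ℚ ≤ s i
    s-nonneg i = ≤-trans (r-nonneg i) (proj₁ F i)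

    rel≤T : ∀ i → rel I i ≤ T
    rel≤T i = ≤-trans (proj₁ F i) (≤-trans (≤φ i (s-nonneg i)) (C≤T i))

    earliest : ∀ x xs → ∃ λ j → j ∈ x ∷ xs × (∀ {i} → i ∈ x ∷ xs → C j ≤ C i)
    earliest x xs = argmin C x xs , argmin-all C (here refl) (All.tabulate there) , λ where
      (here refl) → f[argmin]≤f[⊤] {f = C} x xs
      (there i∈)  → lookup (f[argmin]≤f[xs] {f = C} x xs) i∈

    s<C : ∀ j → 0ℚ < s j → s j < C j
    s<C j s>0 = begin-strict
      s j                        ≡⟨ sym (+-identityʳ (s j)) ⟩
      s j + 0ℚ                   <⟨ +-monoʳ-< (s j) (<-≤-trans βs>0 (≤-+-≥0 _ (α-nonneg j))) ⟩
      s j + (β I * s j + α I j)  ≡⟨ sym (φ-split j (s j)) ⟩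
      C j                        ∎
      where
        open ≤-Reasoning
        βs>0 : 0ℚ < β I * s j
        βs>0 = positive⁻¹ _ {{pos*pos⇒pos (β I) {{positive β-pos}} (s j) {{positive s>0}}}}

    -- A job ending before j starts would end no later than j, forcing s j = C j = 0.
    first-completed-precedes : ∀ {j X} → Unique X → (p : j ∈ X) → (∀ {i} → i ∈ X → C j ≤ C i) →
                               ∀ {i} → i ∈ X ─ p → C j ≤ s i
    first-completed-precedes {j} u p j-first {i} i∈ with proj₂ F i j (λ { refl → ∉-─ u p i∈ })
    ... | inj₂ Cj≤si = Cj≤si
    ... | inj₁ Ci≤sj with 0ℚ <? s j
    ...   | yes sj>0 = ⊥-elim (<-irrefl refl (<-≤-trans (s<C j sj>0) (≤-trans (j-first (∈-─⁻ p i∈)) Ci≤sj)))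
    ...   | no  sj≯0 = ≤-trans (≤-trans (j-first (∈-─⁻ p i∈)) Ci≤sj) (≤-trans (≮⇒≥ sj≯0) (s-nonneg i))

    -- order lists X by completion time in s; run back to back from t, it is done by
    -- the time s has completed X.
    record Compression (t : ℚ) (X : List (Fin n)) : Set where
      field
        order   : List (Fin n)
        unique  : Unique order
        ⊆X      : order ⊆ X
        length≡ : length order ≡ length X
        end≤    : ∀ {M} → t ≤ M → (∀ {i} → i ∈ X → C i ≤ M) → blockEnd t order ≤ M

    compress : ∀ X t → Unique X → (∀ {i} → i ∈ X → t ≤ s i) → Compression t X
    compress X t = go (length X) X t refl
      where
        go : ∀ k X t → length X ≡ k → Unique X → (∀ {i} → i ∈ X → t ≤ s i) → Compression t X
        go _ [] t _ _ _ = record { order = [] ; unique = [] ; ⊆X = λ () ; length≡ = refl ; end≤ = λ t≤M _ → t≤M }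
        go (suc k) (x ∷ xs) t len u t≤s with earliest x xs
        ... | j , p , j-first = record
          { order   = j ∷ order
          ; unique  = unique-∷ (∉-─ u p ∘ ⊆X) unique
          ; ⊆X      = λ { (here refl) → p ; (there i∈) → ∈-─⁻ p (⊆X i∈) }
          ; length≡ = trans (cong suc length≡) (sym (length-removeAt′ (x ∷ xs) (index p)))
          ; end≤    = λ t≤M C≤M → ≤-trans (blockEnd-monoʳ order (φ-monoʳ j (t≤s p)))
                                          (end≤ (C≤M p) (C≤M ∘ ∈-─⁻ p))
          }
          where
            open Compression (go k ((x ∷ xs) ─ p) (C j)
                                 (ℕ.suc-injective (trans (sym (length-removeAt′ (x ∷ xs) (index p))) len))
                                 (unique-─ u p) (first-completed-precedes u p j-first))

    sptPrefix-end≤makespan : ∀ {S g t} → SPTPrefix S g → (∀ {i} → i ∈ g → t ≤ s i) → 0ℚ ≤ t → t ≤ T →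
                             blockEnd t g ≤ T
    sptPrefix-end≤makespan {g = g} {t} G t≤s t≥0 t≤T =
      ≤-trans (sptPrefix-optimal G unique (sptPrefix-⊆ G ∘ ⊆X) (ℕ.≤-reflexive (sym length≡)) t≥0)
              (end≤ t≤T (λ {i} _ → C≤T i))
      where open Compression (compress g t (sptPrefix-unique G) t≤s)

    sptPrefix-end0≤makespan : ∀ {S g} → SPTPrefix S g → blockEnd 0ℚ g ≤ T
    sptPrefix-end0≤makespan G = sptPrefix-end≤makespan G (λ {i} _ → s-nonneg i) ≤-refl T-nonneg

    -- After the first of them completes, the others of X run back to back, and each
    -- job multiplies the elapsed time by at least q.
    q^*≤makespan : ∀ {X m θ} → Unique X → suc m ℕ.≤ length X → 0ℚ ≤ θ → (∀ {i} → i ∈ X → θ ≤ C i) →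
                   q^ m * θ ≤ T
    q^*≤makespan {x ∷ xs} {m} {θ} u len θ≥0 θ≤C with earliest x xs
    ... | j , p , j-first = begin
      q^ m * θ                ≤⟨ *-monoˡ-≤-≥0 (q^ m) (q^-nonneg m) (θ≤C p) ⟩
      q^ m * C j              ≤⟨ *-monoʳ-≤-≥0 (C j) Cj≥0 (q^-mono m≤) ⟩
      q^ (length order) * C j ≤⟨ q^*≤blockEnd order Cj≥0 ⟩
      blockEnd (C j) order    ≤⟨ end≤ (C≤T j) (λ {i} _ → C≤T i) ⟩
      T                       ∎
      where
        open ≤-Reasoning
        open Compression (compress ((x ∷ xs) ─ p) (C j) (unique-─ u p) (first-completed-precedes u p j-first))
        Cj≥0 : 0ℚ ≤ C j
        Cj≥0 = ≤-trans θ≥0 (θ≤C p)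
        m≤ : m ℕ.≤ length order
        m≤ = ℕ.≤-pred (ℕ.≤-trans len (ℕ.≤-reflexive
               (trans (length-removeAt′ (x ∷ xs) (index p)) (cong suc (sym length≡)))))

  makespan-least : ∀ s′ {M} → 0ℚ ≤ M → (∀ y → φ y (s′ y) ≤ M) → makespan I s′ ≤ M
  makespan-least s′ = maxF-least (λ y → φ y (s′ y))

  CompletedBy : ℚ → Partial n → Set
  CompletedBy t σ = ∀ {y v} → σ y ≡ just v → φ y v ≤ t

  completedBy-start : ∀ {t σ} i → 0ℚ ≤ t → CompletedBy t σ → CompletedBy (φ i t) (assign σ i t)
  completedBy-start {t} {σ} i t≥0 done {y} σ′y≡v with y ≟ i
  ... | yes refl = ≤-reflexive (cong (φ y) (sym (just-injective σ′y≡v)))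
  ... | no _     = ≤-trans (done σ′y≡v) (≤φ i t≥0)

  unstarted-assign⁻ : ∀ {σ i v y} → Unstarted (assign σ i v) y → (Unstarted σ ∖ i) y
  unstarted-assign⁻ {σ} {i} {v} {y} u with y ≟ i
  unstarted-assign⁻ {σ} {i} {v} {y} () | yes refl
  ... | no y≢i = u , y≢i

  unstarted-assign⁺ : ∀ {σ i v y} → (Unstarted σ ∖ i) y → Unstarted (assign σ i v) y
  unstarted-assign⁺ {σ} {i} {v} (u , y≢i) = trans (assign-other σ i v y≢i) u

  record SPTTail (t : ℚ) (σ : Partial n) (s′ : Schedule n) : Set₁ where
    field
      rest      : List (Fin n)
      spt       : SPTPrefix (Unstarted σ) rest
      makespan≤ : makespan I s′ ≤ blockEnd t rest

  sptTail-start : ∀ {t σ s′} i → Unstarted σ i → (∀ {y} → Unstarted σ y → α I i ≤ α I y) →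
                  SPTTail (φ i t) (assign σ i t) s′ → SPTTail t σ s′
  sptTail-start {t} {σ} i ui i-min tail = record
    { rest      = i ∷ rest
    ; spt       = pick ui i-min (sptPrefix-resp (unstarted-assign⁻ {σ} {i} {t}) (unstarted-assign⁺ {σ} {i} {t}) spt)
    ; makespan≤ = makespan≤
    }
    where open SPTTail tail

  private
    sptTail-finish : ∀ {t σ s′} → 0ℚ ≤ t → CompletedBy t σ → (∀ k → σ k ≡ just (s′ k)) → SPTTail t σ s′
    sptTail-finish t≥0 done σ≡s′ =
      record { rest = [] ; spt = [] ; makespan≤ = makespan-least _ t≥0 (λ y → done (σ≡s′ y)) }

  nonIdling-after-release : ∀ {t σ s′} → NonIdlingRun I t σ s′ → 0ℚ ≤ t → (∀ y → rel I y ≤ t) →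
                            CompletedBy t σ → SPTTail t σ s′
  nonIdling-after-release (finish σ≡s′) t≥0 _ done = sptTail-finish t≥0 done σ≡s′
  nonIdling-after-release (start i ((_ , ui) , i-min) run) t≥0 released done =
    sptTail-start i ui (λ uy → i-min _ (released _ , uy))
      (nonIdling-after-release run (φ-nonneg i t≥0) (λ y → ≤-trans (released y) (≤φ i t≥0))
                               (completedBy-start i t≥0 done))
  nonIdling-after-release (wait j noPending (uj , _) _) _ released _ = ⊥-elim (noPending j (released j , uj))

  nonInterfering-after-release : ∀ {t σ s′} → NonInterferingRun I t σ s′ → 0ℚ ≤ t → (∀ y → rel I y ≤ t) →
                                 CompletedBy t σ → SPTTail t σ s′
  nonInterfering-after-release (finish σ≡s′) t≥0 _ done = sptTail-finish t≥0 done σ≡s′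
  nonInterfering-after-release (start i ((_ , ui) , i-min) _ run) t≥0 released done =
    sptTail-start i ui (λ uy → i-min _ (released _ , uy))
      (nonInterfering-after-release run (φ-nonneg i t≥0) (λ y → ≤-trans (released y) (≤φ i t≥0))
                                    (completedBy-start i t≥0 done))
  nonInterfering-after-release (idle _ j _ _ t<rj _ _) _ released _ = ⊥-elim (<-irrefl refl (<-≤-trans t<rj (released j)))
  nonInterfering-after-release (wait j noPending (uj , _) _) _ released _ = ⊥-elim (noPending j (released j , uj))

  module TwoReleases (r : ℚ) (r>0 : 0ℚ < r) (two : TwoReleaseTimes I r) where

    ReleasedAt0 : Fin n → Set
    ReleasedAt0 i = rel I i ≡ 0ℚ

    0≤r : 0ℚ ≤ r
    0≤r = <⇒≤ r>0

    r≤qr : r ≤ q * r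
    r≤qr = ≤-trans (≤-reflexive (sym (*-identityˡ r))) (*-monoʳ-≤-≥0 r 0≤r 1≤q)

    released-from-r : ∀ {t} → r ≤ t → ∀ y → rel I y ≤ t
    released-from-r {t} r≤t y with two y
    ... | inj₁ ry≡0 = subst (_≤ t) (sym ry≡0) (≤-trans 0≤r r≤t)
    ... | inj₂ ry≡r = subst (_≤ t) (sym ry≡r) r≤t

    released-before-r : ∀ {t y} → t < r → rel I y ≤ t → ReleasedAt0 y
    released-before-r {t} {y} t<r ry≤t with two y
    ... | inj₁ ry≡0 = ry≡0
    ... | inj₂ ry≡r = ⊥-elim (<-irrefl refl (<-≤-trans t<r (subst (_≤ t) ry≡r ry≤t)))

    released-after : ∀ {t y} → 0ℚ ≤ t → t < rel I y → rel I y ≡ r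
    released-after {t} {y} t≥0 t<ry with two y
    ... | inj₁ ry≡0 = ⊥-elim (<-irrefl refl (<-≤-trans t<ry (subst (_≤ t) (sym ry≡0) t≥0)))
    ... | inj₂ ry≡r = ry≡r

    pending-at0 : ∀ {σ t y} → 0ℚ ≤ t → ReleasedAt0 y → Unstarted σ y → Pending I σ t y
    pending-at0 {t = t} t≥0 ry≡0 uy = subst (_≤ t) (sym ry≡0) t≥0 , uy

    prefix-before-r-shorter : ∀ {P H p} → SPTPrefix ReleasedAt0 P → blockEnd 0ℚ P < r →
                              SPTPrefix ReleasedAt0 H → length H ≡ suc p → r ≤ blockEnd 0ℚ H → length P ℕ.≤ p
    prefix-before-r-shorter {P} {p = p} sptP P<r sptH lenH r≤H with length P ℕ.≤? p
    ... | yes P≤p = P≤p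
    ... | no  P≰p = ⊥-elim (<-irrefl refl (<-≤-trans P<r (≤-trans r≤H
            (sptPrefix-optimal sptH (sptPrefix-unique sptP) (sptPrefix-⊆ sptP)
               (ℕ.≤-trans (ℕ.≤-reflexive lenH) (ℕ.≰⇒> P≰p)) ≤-refl))))

    -- Before r both algorithms run jobs released at 0 back to back in SPT order;
    -- P lists the jobs started so far.
    record Started (t : ℚ) (σ : Partial n) (P : List (Fin n)) : Set₁ where
      field
        t≡end       : t ≡ blockEnd 0ℚ P
        spt         : SPTPrefix ReleasedAt0 P
        ∉⇒unstarted : ∀ {y} → y ∉ P → Unstarted σ y
        unstarted⇒∉ : ∀ {y} → Unstarted σ y → y ∉ P
        completed   : CompletedBy t σ

      t-nonneg : 0ℚ ≤ t
      t-nonneg = subst (0ℚ ≤_) (sym t≡end) (blockEnd-nonneg P ≤-refl)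

    started-initially : Started 0ℚ (λ _ → nothing) []
    started-initially = record
      { t≡end = refl ; spt = [] ; ∉⇒unstarted = λ _ → refl ; unstarted⇒∉ = λ _ () ; completed = λ () }

    started-start : ∀ {t σ P i} → Started t σ P → t < r → MinPending I σ t i →
                    Started (φ i t) (assign σ i t) (P ∷ʳ i)
    started-start {t} {σ} {P} {i} st t<r ((ri≤t , ui) , i-min) = record
      { t≡end       = trans (cong (φ i) t≡end) (sym (blockEnd-++ 0ℚ P [ i ]))
      ; spt         = sptPrefix-∷ʳ spt (released-before-r t<r ri≤t) (unstarted⇒∉ ui)
                        (λ y-at0 y∉P → i-min _ (pending-at0 {σ} t-nonneg y-at0 (∉⇒unstarted y∉P)))
      ; ∉⇒unstarted = λ y∉ → unstarted-assign⁺ {σ}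
                        (∉⇒unstarted (y∉ ∘ ∈-++⁺ˡ) , λ { refl → y∉ (∈-++⁺ʳ P (here refl)) })
      ; unstarted⇒∉ = λ u y∈ → let (uσ , y≢i) = unstarted-assign⁻ {σ} u in
                        [ unstarted⇒∉ uσ , (λ { (here y≡i) → y≢i y≡i }) ]′ (∈-++⁻ P y∈)
      ; completed   = completedBy-start i t-nonneg completed
      }
      where open Started st

    record Straddle (P : List (Fin n)) (k : Fin n) : Set₁ where
      field
        spt-before : SPTPrefix ReleasedAt0 P
        before     : blockEnd 0ℚ P < r
        spt-after  : SPTPrefix ReleasedAt0 (P ∷ʳ k)
        after      : r ≤ blockEnd 0ℚ (P ∷ʳ k)

    straddle : ∀ {t σ σ′ P k} → Started t σ P → t < r → Started (φ k t) σ′ (P ∷ʳ k) → r ≤ φ k t → Straddle P k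
    straddle st t<r st′ r≤φ = record
      { spt-before = Started.spt st
      ; before     = subst (_< r) (Started.t≡end st) t<r
      ; spt-after  = Started.spt st′
      ; after      = subst (r ≤_) (Started.t≡end st′) r≤φ
      }

    module Bounds (s : Schedule n) (F : Feasible I s) where
      open LowerBounds s F

      C<qr⇒released-at0 : ∀ {i} → C i < q * r → ReleasedAt0 i
      C<qr⇒released-at0 {i} Ci<qr with two i
      ... | inj₁ ri≡0 = ri≡0
      ... | inj₂ ri≡r = ⊥-elim (<-irrefl refl (<-≤-trans Ci<qr
              (≤-trans (≤-+-≥0 (q * r) (α-nonneg i)) (φ-monoʳ i (subst (_≤ s i) ri≡r (proj₁ F i))))))

      -- Jobs completing before θ ≤ qr were released at 0, so p + 1 of them would
      -- end, back to back from 0, before the SPT prefix H does.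
      few-complete-before : ∀ {H p θ E} → SPTPrefix ReleasedAt0 H → length H ≡ suc p → θ ≤ blockEnd 0ℚ H →
                            θ ≤ q * r → Unique E → length (filter (λ i → C i <? θ) E) ℕ.≤ p
      few-complete-before {H} {p} {θ} {E} sptH lenH θ≤H θ≤qr u with length (filter (λ i → C i <? θ) E) ℕ.≤? p
      ... | yes few = few
      ... | no many = ⊥-elim (too-many (filter (λ i → C i <? θ) E) (filter⁺ _ u)
                              (λ i∈ → proj₂ (∈-filter⁻ (λ i → C i <? θ) {xs = E} i∈)) (ℕ.≰⇒> many))
        where
          too-many : ∀ D → Unique D → (∀ {i} → i ∈ D → C i < θ) → suc p ℕ.≤ length D → ⊥
          too-many (d ∷ ds) uD early len = <-irrefl refl (begin-strict
            θ                    ≤⟨ θ≤H ⟩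
            blockEnd 0ℚ H        ≤⟨ sptPrefix-optimal sptH unique
                                      (λ i∈ → C<qr⇒released-at0 (<-≤-trans (early (⊆X i∈)) θ≤qr))
                                      (ℕ.≤-trans (ℕ.≤-reflexive lenH) (ℕ.≤-trans len (ℕ.≤-reflexive (sym length≡))))
                                      ≤-refl ⟩
            blockEnd 0ℚ order    ≤⟨ end≤ (φ-nonneg last (s-nonneg last)) C≤last ⟩
            C last               <⟨ early last∈ ⟩
            θ                    ∎)
            where
              open ≤-Reasoning
              open Compression (compress (d ∷ ds) 0ℚ uD (λ {i} _ → s-nonneg i))
              last : Fin n
              last = argmax C d ds
              last∈ : last ∈ d ∷ ds
              last∈ = argmax-all C (here refl) (All.tabulate there)
              C≤last : ∀ {i} → i ∈ d ∷ ds → C i ≤ C last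
              C≤last (here refl) = f[⊥]≤f[argmax] {f = C} d ds
              C≤last (there i∈)  = lookup (f[xs]≤f[argmax] {f = C} d ds) i∈

      q^*≤makespan-via-prefix : ∀ {H p θ E m} → SPTPrefix ReleasedAt0 H → length H ≡ suc p →
                                θ ≤ blockEnd 0ℚ H → 0ℚ ≤ θ → θ ≤ q * r →
                                Unique E → suc (m ℕ.+ p) ℕ.≤ length E → q^ m * θ ≤ T
      q^*≤makespan-via-prefix {p = p} {θ} {E} {m} sptH lenH θ≤H θ≥0 θ≤qr u len =
        q^*≤makespan (filter⁺ late? u) many-late θ≥0 (λ i∈ → ≮⇒≥ (proj₂ (∈-filter⁻ late? {xs = E} i∈)))
        where
          early? = λ i → C i <? θ
          late?  = ∁? early?
          few-early = few-complete-before sptH lenH θ≤H θ≤qr u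
          many-late : suc m ℕ.≤ length (filter late? E)
          many-late = ℕ.+-cancelʳ-≤ p (suc m) _ (begin
            suc m ℕ.+ p                                           ≤⟨ len ⟩
            length E                                              ≡⟨ sym (length-filter-∁ early? E) ⟩
            length (filter early? E) ℕ.+ length (filter late? E)  ≤⟨ ℕ.+-monoˡ-≤ _ few-early ⟩
            p ℕ.+ length (filter late? E)                         ≡⟨ ℕ.+-comm p _ ⟩
            length (filter late? E) ℕ.+ p                         ∎)
            where open ℕ.≤-Reasoning

      -- m counts the jobs run after the one straddling r; jobs lists them together
      -- with the p + 1 jobs up to it.
      record TailBound (s′ : Schedule n) (θ : ℚ) (p : ℕ) : Set where
        field
          m      : ℕ
          jobs   : List (Fin n)
          unique : Unique jobs
          long   : suc (m ℕ.+ p) ℕ.≤ length jobs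
          bound  : makespan I s′ ≤ q^ m * θ + T

      tailBound⇒≤2T : ∀ {H p p′ θ s′} → SPTPrefix ReleasedAt0 H → length H ≡ suc p → θ ≤ blockEnd 0ℚ H →
                      0ℚ ≤ θ → θ ≤ q * r → p ℕ.≤ p′ → TailBound s′ θ p′ → makespan I s′ ≤ T + T
      tailBound⇒≤2T sptH lenH θ≤H θ≥0 θ≤qr p≤p′ tb = ≤-trans bound (+-monoˡ-≤ T
        (q^*≤makespan-via-prefix sptH lenH θ≤H θ≥0 θ≤qr unique (ℕ.≤-trans (ℕ.s≤s (ℕ.+-monoʳ-≤ m p≤p′)) long)))
        where open TailBound tb

      sptTail-bound : ∀ {t σ s′} → (tail : SPTTail t σ s′) → makespan I s′ ≤ q^ (length (SPTTail.rest tail)) * t + T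
      sptTail-bound {t} tail = ≤-trans makespan≤ (≤-trans (≤-reflexive (blockEnd-affine rest t))
        (+-monoʳ-≤ (q^ (length rest) * t) (sptPrefix-end0≤makespan spt)))
        where open SPTTail tail

      finished-before-r : ∀ {t σ P s′} → Started t σ P → (∀ k → σ k ≡ just (s′ k)) → makespan I s′ ≤ T
      finished-before-r st σ≡s′ = makespan-least _ T-nonneg λ y →
        ≤-trans (completed (σ≡s′ y)) (subst (_≤ T) (sym t≡end) (sptPrefix-end0≤makespan spt))
        where open Started st

      waited-for-r : ∀ {t σ P s′} j → Started t σ P → NoPending I σ t → Unstarted σ j →
                     (0ℚ ≤ rel I j → (∀ y → rel I y ≤ rel I j) → CompletedBy (rel I j) σ → SPTTail (rel I j) σ s′) →
                     makespan I s′ ≤ T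
      waited-for-r {t} {σ} j st none uj after-release = ≤-trans makespan≤
        (sptPrefix-end≤makespan spt (λ {i} i∈ → subst (_≤ s i) (trans (at-r (sptPrefix-⊆ spt i∈)) (sym (at-r uj)))
                                                        (proj₁ F i))
           (r-nonneg j) (rel≤T j))
        where
          later : ∀ {i} → Unstarted σ i → t < rel I i
          later {i} ui = ≰⇒> λ ri≤t → none i (ri≤t , ui)
          at-r : ∀ {i} → Unstarted σ i → rel I i ≡ r
          at-r ui = released-after (Started.t-nonneg st) (later ui)
          open SPTTail (after-release (r-nonneg j) (released-from-r (≤-reflexive (sym (at-r uj))))
                          (λ σy → ≤-trans (Started.completed st σy) (<⇒≤ (later uj))))

      tailBound-after : ∀ {t σ P i s′ θ} → Started t σ (P ∷ʳ i) → (tail : SPTTail t σ s′) →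
                        makespan I s′ ≤ q^ (length (SPTTail.rest tail)) * θ + T → TailBound s′ θ (length P)
      tailBound-after {P = P} {i} st tail bound = record
        { m      = length rest
        ; jobs   = P ++ i ∷ rest
        ; unique = subst Unique (++-assoc P [ i ] rest)
                     (++⁺ (sptPrefix-unique (Started.spt st)) (sptPrefix-unique spt)
                          (λ (y∈ , y∈rest) → Started.unstarted⇒∉ st (sptPrefix-⊆ spt y∈rest) y∈))
        ; long   = ℕ.≤-reflexive (sym (length-++-∷ P i rest))
        ; bound  = bound
        }
        where open SPTTail tail

      nonIdling-outcome : ∀ {t σ P s₁} → NonIdlingRun I t σ s₁ → Started t σ P → t < r →
                          makespan I s₁ ≤ T ⊎ ∃₂ λ P k → Straddle P k × TailBound s₁ (blockEnd 0ℚ (P ∷ʳ k)) (length P)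
      nonIdling-outcome (finish σ≡s₁)            st _ = inj₁ (finished-before-r st σ≡s₁)
      nonIdling-outcome (wait j none (uj , _) run) st _ = inj₁ (waited-for-r j st none uj (nonIdling-after-release run))
      nonIdling-outcome {t} {σ} {P} (start i minPending run) st t<r with φ i t <? r
      ... | yes φ<r = nonIdling-outcome run (started-start st t<r minPending) φ<r
      ... | no φ≮r = inj₂ (P , i , straddle st t<r st′ (≮⇒≥ φ≮r) ,
                           tailBound-after st′ tail (≤-trans (sptTail-bound tail)
                             (≤-reflexive (cong (λ x → q^ (length (SPTTail.rest tail)) * x + T) (Started.t≡end st′)))))
        where
          st′ = started-start st t<r minPending
          tail = nonIdling-after-release run (Started.t-nonneg st′) (released-from-r (≮⇒≥ φ≮r)) (Started.completed st′)

      -- Jobs released at r did not interfere, so i was also a first SPT choice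
      -- among all unstarted jobs and the whole run from t is an SPT tail.
      nonInterfering-straddle-bound :
        ∀ {t σ i s₂} → 0ℚ ≤ t → t < r → MinPending I σ t i →
        (∀ j → α I j < α I i → t < rel I j → ¬ (rel I j < φ i t)) →
        (tail : SPTTail (φ i t) (assign σ i t) s₂) → makespan I s₂ ≤ q^ (length (SPTTail.rest tail)) * (q * r) + T
      nonInterfering-straddle-bound {t} {σ} {i} {s₂} t≥0 t<r minPending quiet tail with r <? φ i t
      ... | no r≮φ = ≤-trans (sptTail-bound tail)
              (+-monoˡ-≤ T (*-monoˡ-≤-≥0 (q^ m) (q^-nonneg m) (≤-trans (≮⇒≥ r≮φ) r≤qr)))
        where m = length (SPTTail.rest tail)
      ... | yes r<φ = begin
        makespan I s₂       ≤⟨ sptTail-bound (sptTail-start i (proj₂ (proj₁ minPending)) i-min tail) ⟩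
        q^ m * q * t + T    ≡⟨ cong (_+ T) (*-assoc (q^ m) q t) ⟩
        q^ m * (q * t) + T  ≤⟨ +-monoˡ-≤ T (*-monoˡ-≤-≥0 (q^ m) (q^-nonneg m) (*-monoˡ-≤-≥0 q q-nonneg (<⇒≤ t<r))) ⟩
        q^ m * (q * r) + T  ∎
        where
          open ≤-Reasoning
          m = length (SPTTail.rest tail)
          i-min : ∀ {y} → Unstarted σ y → α I i ≤ α I y
          i-min {y} uy with two y
          ... | inj₁ ry≡0 = proj₂ minPending y (pending-at0 {σ} t≥0 ry≡0 uy)
          ... | inj₂ ry≡r = ≮⇒≥ λ αy<αi →
                              quiet y αy<αi (subst (t <_) (sym ry≡r) t<r) (subst (_< φ i t) (sym ry≡r) r<φ)

      nonInterfering-outcome : ∀ {t σ P s₂} → NonInterferingRun I t σ s₂ → Started t σ P → t < r →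
                               makespan I s₂ ≤ T ⊎ ∃₂ λ P k → Straddle P k × TailBound s₂ (q * r) (length P)
      nonInterfering-outcome (finish σ≡s₂)            st _ = inj₁ (finished-before-r st σ≡s₂)
      nonInterfering-outcome (wait j none (uj , _) run) st _ = inj₁ (waited-for-r j st none uj (nonInterfering-after-release run))
      nonInterfering-outcome {t} {σ} {P} (start i minPending quiet run) st t<r with φ i t <? r
      ... | yes φ<r = nonInterfering-outcome run (started-start st t<r minPending) φ<r
      ... | no φ≮r = inj₂ (P , i , straddle st t<r st′ (≮⇒≥ φ≮r) ,
                           tailBound-after st′ tail (nonInterfering-straddle-bound (Started.t-nonneg st) t<r minPending quiet tail))
        where
          st′ = started-start st t<r minPending
          tail = nonInterfering-after-release run (Started.t-nonneg st′) (released-from-r (≮⇒≥ φ≮r)) (Started.completed st′)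
      nonInterfering-outcome {t} {σ} {P} {s₂} (idle i j minPending _ t<rj rj<φ run) st t<r =
        idle-outcome (nonInterfering-after-release run (r-nonneg j) (released-from-r (≤-reflexive (sym rj≡r)))
                        (λ σy → ≤-trans (Started.completed st σy) (<⇒≤ t<rj)))
        where
          rj≡r = released-after (Started.t-nonneg st) t<rj
          idle-outcome : SPTTail (rel I j) σ s₂ →
                         makespan I s₂ ≤ T ⊎ ∃₂ λ P k → Straddle P k × TailBound s₂ (q * r) (length P)
          idle-outcome record { rest = [] ; makespan≤ = makespan≤ } = inj₁ (≤-trans makespan≤ (rel≤T j))
          idle-outcome tail@record { rest = x ∷ xs ; spt = spt } =
            inj₂ (P , i , straddle st t<r (started-start st t<r minPending) (<⇒≤ (subst (_< φ i t) rj≡r rj<φ)) , record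
              { m      = length xs
              ; jobs   = P ++ x ∷ xs
              ; unique = ++⁺ (sptPrefix-unique (Started.spt st)) (sptPrefix-unique spt)
                             (λ (y∈P , y∈) → Started.unstarted⇒∉ st (sptPrefix-⊆ spt y∈) y∈P)
              ; long   = ℕ.≤-reflexive (sym (length-++-∷ P x xs))
              ; bound  = ≤-trans (sptTail-bound tail)
                           (≤-reflexive (trans (cong (_+ T) (*-assoc (q^ length xs) q (rel I j)))
                                               (cong (λ z → q^ length xs * (q * z) + T) rj≡r)))
              })

      best-of-two≤2T : ∀ {s₁ s₂} → NonIdlingSchedule I s₁ → NonInterferingSchedule I s₂ →
                       makespan I s₁ ⊓ makespan I s₂ ≤ T + T
      best-of-two≤2T {s₁} {s₂} ni nint with nonIdling-outcome ni started-initially r>0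
      ... | inj₁ s₁≤T = p≤q⇒p⊓r≤q (makespan I s₂) (≤-trans s₁≤T T≤2T)
      ... | inj₂ (P , k , S , tail₁) with blockEnd 0ℚ (P ∷ʳ k) ≤? q * r
      ...   | yes H≤qr = p≤q⇒p⊓r≤q (makespan I s₂)
              (tailBound⇒≤2T spt-after (length-∷ʳ P k) ≤-refl (blockEnd-nonneg (P ∷ʳ k) ≤-refl) H≤qr ℕ.≤-refl tail₁)
        where open Straddle S
      ...   | no H≰qr with nonInterfering-outcome nint started-initially r>0
      ...     | inj₁ s₂≤T = p≤q⇒r⊓p≤q (makespan I s₁) (≤-trans s₂≤T T≤2T)
      ...     | inj₂ (P′ , k′ , S′ , tail₂) = p≤q⇒r⊓p≤q (makespan I s₁)
                (tailBound⇒≤2T spt-after (length-∷ʳ P k) (<⇒≤ (≰⇒> H≰qr)) (*-nonneg q-nonneg 0≤r) ≤-refl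
                   (prefix-before-r-shorter spt-before before (Straddle.spt-after S′) (length-∷ʳ P′ k′) (Straddle.after S′))
                   tail₂)
        where open Straddle S

    interferes? : ∀ i t → Decidable (λ j → α I j < α I i × t < rel I j × rel I j < φ i t)
    interferes? i t j = (α I j <? α I i) ×-dec (t <? rel I j) ×-dec (rel I j <? φ i t)

    nonInterferingRun-exists : ∀ k t σ → unstartedCount σ ≡ k → 0ℚ ≤ t → ∃ (NonInterferingRun I t σ)
    nonInterferingRun-exists-from-r : ∀ k u σ → unstartedCount σ ≡ suc k → r ≤ u → ∀ {i₀} → Pending I σ u i₀ →
                                      ∃ (NonInterferingRun I u σ)

    nonInterferingRun-exists zero t σ none _ = proj₁ done , finish (proj₂ done)
      where done = completion σ (allStarted σ none)
    nonInterferingRun-exists (suc k) t σ count t≥0 with argmin-Fin (pending? I σ t) (α I)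
    ... | inj₂ (i , minPending) with any? (interferes? i t)
    ...   | no quiet = proj₁ rest , start i minPending (λ j αj<αi t<rj rj<φ → quiet (j , αj<αi , t<rj , rj<φ)) (proj₂ rest)
      where rest = nonInterferingRun-exists k _ _ (unstartedCount-start σ i _ (proj₂ (proj₁ minPending)) count) (φ-nonneg i t≥0)
    ...   | yes (j , αj<αi , t<rj , rj<φ) = proj₁ rest , idle i j minPending αj<αi t<rj rj<φ (proj₂ rest)
      where rest = nonInterferingRun-exists-from-r k (rel I j) σ count (≤-reflexive (sym (released-after t≥0 t<rj)))
                     (≤-trans (proj₁ (proj₁ minPending)) (<⇒≤ t<rj) , proj₂ (proj₁ minPending))
    nonInterferingRun-exists (suc k) t σ count t≥0 | inj₁ noPending with argmin-Fin (unstarted? σ) (rel I)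
    ...   | inj₁ started = proj₁ done , finish (proj₂ done)
      where done = completion σ started
    ...   | inj₂ (j , uj , next) = proj₁ rest , wait j noPending (uj , next) (proj₂ rest)
      where rest = nonInterferingRun-exists-from-r k (rel I j) σ count
                     (≤-reflexive (sym (released-after t≥0 (≰⇒> λ rj≤t → noPending j (rj≤t , uj))))) (≤-refl , uj)

    nonInterferingRun-exists-from-r k u σ count r≤u p₀ with argmin-Fin (pending? I σ u) (α I)
    ... | inj₁ none = ⊥-elim (none _ p₀)
    ... | inj₂ (i , minPending) = proj₁ rest , start i minPending
          (λ j _ u<rj _ → <-irrefl refl (<-≤-trans u<rj (released-from-r r≤u j))) (proj₂ rest)
      where rest = nonInterferingRun-exists k _ _ (unstartedCount-start σ i _ (proj₂ (proj₁ minPending)) count)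
                                            (φ-nonneg i (≤-trans 0≤r r≤u))

theorem14 : (n : ℕ) (I : Instance n) (r : ℚ) → Valid I → 0ℚ < r → TwoReleaseTimes I r →
    (∃ λ s₁ → NonIdlingSchedule I s₁) × (∃ λ s₂ → NonInterferingSchedule I s₂) ×
    (∀ s₁ s₂ → NonIdlingSchedule I s₁ → NonInterferingSchedule I s₂ →
      ∀ s → Feasible I s →
        makespan I s₁ ⊓ makespan I s₂ ≤ makespan I s + makespan I s)
theorem14 n I r V r>0 two =
  nonIdlingRun-exists I _ 0ℚ (λ _ → nothing) refl ,
  nonInterferingRun-exists _ 0ℚ (λ _ → nothing) refl ≤-refl ,
  λ s₁ s₂ ni nint s F → Bounds.best-of-two≤2T s F ni nint
  where
    open Deteriorating I V
    open TwoReleases r r>0 two
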